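{- Let $G$ be a cubic graph on $n$ vertices and let $\tau(v)=2$ for every vertex $v$. Then $\frac{n+2}{4}\leq wdyn_\tau(G)$.
   Context: A set $D\subseteq V(G)$ is a $\tau$-weak dynamic monopoly if $V(G)$ can be partitioned into $D_0=D,D_1,\ldots,D_t$ such that for every $i\ge 1$, every vertex $v\in D_i$ has at least $\tau(v)$ neighbors in $D_{i-1}$. $wdyn_\tau(G)$ denotes the minimum size of a $\tau$-weak dynamic monopoly. -}

module Defs where

open import Data.Nat using (ℕ; zero; suc; _≟_)
open import Data.Fin using (Fin)
open import Data.Fin.Subset using (Subset; _∈_; _∉_; _∩_; ∣_∣)
open import Data.Vec using (tabulate)
open import Data.Bool using (Bool)
open import Data.Product using (Σ; _×_)
open import Relation.Nullary.Decidable using (⌊_⌋)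
open import Relation.Binary.PropositionalEquality using (_≡_)
open import Function.Bundles using (_⇔_)

record Graph (n : ℕ) : Set where
  field
    N         : Fin n → Subset n
    symmetric : ∀ u v → u ∈ N v → v ∈ N u
    irrefl    : ∀ v → v ∉ N v

open Graph public

deg : ∀ {n} → Graph n → Fin n → ℕ
deg G v = ∣ N G v ∣

Cubic : ∀ {n} → Graph n → Set
Cubic {n} G = ∀ (v : Fin n) → deg G v ≡ 3

Threshold : ℕ → Set
Threshold n = Fin n → ℕ

layer : ∀ {n} → (Fin n → ℕ) → ℕ → Subset n
layer ℓ i = tabulate (λ u → ⌊ ℓ u ≟ i ⌋)

-- ℓ describes a partition V = D_0 ∪ D_1 ∪ … ∪ D_t (D_i = layer ℓ i, t = max ℓ)
-- witnessing that D_0 = D is a τ-weak dynamic monopoly: every v ∈ D_{i+1}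
-- has at least τ(v) neighbours in D_i.
IsWeakDynMonWitness : ∀ {n} → Graph n → Threshold n → Subset n → (Fin n → ℕ) → Set
IsWeakDynMonWitness {n} G τ D ℓ =
  (∀ v → (v ∈ D) ⇔ (ℓ v ≡ 0)) ×
  (∀ v i → ℓ v ≡ suc i → τ v Data.Nat.≤ ∣ N G v ∩ layer ℓ i ∣)

IsWeakDynMon : ∀ {n} → Graph n → Threshold n → Subset n → Set
IsWeakDynMon {n} G τ D = Σ (Fin n → ℕ) (IsWeakDynMonWitness G τ D)

module Submission where

-- Fix a witness ℓ for the 2-weak dynamic monopoly D (vertex v lies in layer
-- D_{ℓ v}). For a vertex v count its neighbours one layer below (lower v),
-- one layer above (upper v) and in any other layer (side v). Since G is
-- cubic, lower v + upper v + side v = 3, and every edge between consecutive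
-- layers is counted once by `lower` and once by `upper`, so
--     2·Σ lower + Σ side = 3n.                                        (1)
-- The charge 2·lower v + 4·[v ∈ D] is at least 4 at every vertex, since a
-- vertex outside D has at least two neighbours in the previous layer. At a
-- vertex w of the last layer upper w = 0; either side w = 0, so lower w = 3
-- and the charge of w is at least 6, or w has a side-neighbour x ≠ w and
-- then Σ side ≥ 2. In both cases
--     4n + e ≤ 2·Σ lower + 4·|D|   and   2 ≤ e + Σ side               (2)
-- for some e, and (1), (2) give 4·|D| ≥ n + 2.

open import Defs
open import Data.Nat using (ℕ; _+_; _*_; _≤_; suc)
open import Data.Fin using (Fin)
open import Data.Fin.Subset using (Subset; ∣_∣)

open import Data.Nat using (zero; _<_; _≟_; z≤n; s≤s)
open import Data.Nat.Properties
open import Data.Fin using (zero; suc; punchIn; punchOut)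
open import Data.Fin.Properties using (punchIn-punchOut)
open import Data.Fin.Subset using (_∩_)
open import Data.Bool using (Bool; true; false; _∧_; not)
open import Data.Bool.Properties using (∧-comm)
open import Data.Vec using ([]; _∷_; lookup)
open import Data.Vec.Properties using (lookup-zipWith; lookup∘tabulate; []=⇒lookup; lookup⇒[]=)
open import Data.Vec.Functional using (removeAt)
open import Data.List using (allFin)
open import Data.List.Relation.Unary.All as All using ()
open import Data.List.Membership.Propositional.Properties using (∈-allFin)
open import Data.List.Extrema.Nat using (argmax; f[xs]≤f[argmax])
open import Data.Product using (∃; _,_; _×_; proj₁; proj₂)
open import Data.Empty using (⊥-elim)
open import Function using (_∘_; flip)
open import Function.Bundles using (Equivalence)
open import Relation.Nullary.Decidable using (⌊_⌋; yes; no; isYes≗does)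
open import Relation.Binary.PropositionalEquality
open import Algebra.Properties.Semiring.Sum +-*-semiring
  using (sum; sum-cong-≗; sum-remove; ∑-distrib-+; ∑-comm; *-distribˡ-sum)
open import Data.Nat.Solver using (module +-*-Solver)
open +-*-Solver using (solve; _:+_; _:*_; _:=_; con)

𝟙 : Bool → ℕ
𝟙 true  = 1
𝟙 false = 0

𝟙-∧ : ∀ x y → 𝟙 (x ∧ y) ≡ 𝟙 x * 𝟙 y
𝟙-∧ true  y = sym (+-identityʳ (𝟙 y))
𝟙-∧ false y = refl

∣p∣≡sum : ∀ {n} (p : Subset n) → ∣ p ∣ ≡ sum (𝟙 ∘ lookup p)
∣p∣≡sum []          = refl
∣p∣≡sum (true  ∷ p) = cong suc (∣p∣≡sum p)
∣p∣≡sum (false ∷ p) = ∣p∣≡sum p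

sum-const : ∀ n c → sum {n} (λ _ → c) ≡ n * c
sum-const zero    c = refl
sum-const (suc n) c = cong (c +_) (sum-const n c)

sum-mono-≤ : ∀ {n} {f g : Fin n → ℕ} → (∀ i → f i ≤ g i) → sum f ≤ sum g
sum-mono-≤ {zero}  f≤g = z≤n
sum-mono-≤ {suc n} f≤g = +-mono-≤ (f≤g zero) (sum-mono-≤ (f≤g ∘ suc))

term≤sum : ∀ {n} (f : Fin n → ℕ) i → f i ≤ sum f
term≤sum {suc n} f i = ≤-trans (m≤m+n (f i) _) (≤-reflexive (sym (sum-remove {i = i} f)))

two-terms≤sum : ∀ {n} (f : Fin n → ℕ) {i j} → i ≢ j → f i + f j ≤ sum f
two-terms≤sum {suc n} f {i} {j} i≢j = begin
  f i + f j                       ≡⟨ cong (λ k → f i + f k) (sym (punchIn-punchOut i≢j)) ⟩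
  f i + removeAt f i (punchOut i≢j) ≤⟨ +-monoʳ-≤ (f i) (term≤sum (removeAt f i) _) ⟩
  f i + sum (removeAt f i)        ≡⟨ sym (sum-remove f) ⟩
  sum f                           ∎
  where open ≤-Reasoning

sum-bonus : ∀ {n} (g : Fin n → ℕ) {c e} w → (∀ i → c ≤ g i) → c + e ≤ g w →
            n * c + e ≤ sum g
sum-bonus {suc n} g {c} {e} w g≥c gw≥ = begin
  c + n * c + e            ≡⟨ solve 3 (λ c m e → c :+ m :+ e := c :+ e :+ m) refl c (n * c) e ⟩
  c + e + n * c            ≤⟨ +-mono-≤ gw≥ rest≥ ⟩
  g w + sum (removeAt g w) ≡⟨ sym (sum-remove g) ⟩
  sum g                    ∎
  where
  open ≤-Reasoning
  rest≥ : n * c ≤ sum (removeAt g w)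
  rest≥ = subst (_≤ sum (removeAt g w)) (sum-const n c) (sum-mono-≤ (λ i → g≥c (punchIn w i)))

positive-term : ∀ {n} (f : Fin n → ℕ) → 0 < sum f → ∃ λ i → 0 < f i
positive-term {suc n} f 0<sum with f zero in f₀
... | suc _ = zero , subst (0 <_) (sym f₀) (s≤s z≤n)
... | zero  with positive-term (f ∘ suc) 0<sum
...   | i , 0<fi = suc i , 0<fi

maximum-attained : ∀ {n} (f : Fin (suc n) → ℕ) → ∃ λ w → ∀ u → f u ≤ f w
maximum-attained {n} f =
  argmax f zero (allFin (suc n)) ,
  λ u → All.lookup (f[xs]≤f[argmax] {f = f} zero (allFin (suc n))) (∈-allFin u)

scale-partition-of-one : ∀ a b c d → b + c + d ≡ 1 → a ≡ a * b + a * c + a * d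
scale-partition-of-one a b c d b+c+d≡1 = begin
  a                     ≡⟨ sym (*-identityʳ a) ⟩
  a * 1                 ≡⟨ cong (a *_) (sym b+c+d≡1) ⟩
  a * (b + c + d)       ≡⟨ solve 4 (λ a b c d → a :* (b :+ c :+ d) := a :* b :+ a :* c :+ a :* d) refl a b c d ⟩
  a * b + a * c + a * d ∎
  where open ≡-Reasoning

justBelow justAbove apart : ℕ → ℕ → Bool
justBelow m k = ⌊ suc m ≟ k ⌋
justAbove m k = justBelow k m
apart     m k = not (justBelow m k) ∧ not (justAbove m k)

-- Two layers are in exactly one of these relations: m + 1 = k and
-- k + 1 = m cannot hold together.
layer-trichotomy : ∀ m k → 𝟙 (justBelow m k) + 𝟙 (justAbove m k) + 𝟙 (apart m k) ≡ 1
layer-trichotomy m k with suc m ≟ k | suc k ≟ m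
... | yes m+1≡k | yes k+1≡m =
  ⊥-elim (<⇒≢ (m<n⇒m<1+n (n<1+n m)) (sym (trans (cong suc m+1≡k) k+1≡m)))
... | yes _ | no _  = refl
... | no _  | yes _ = refl
... | no _  | no _  = refl

apart-sym : ∀ m k → apart m k ≡ apart k m
apart-sym m k = ∧-comm (not (justBelow m k)) (not (justAbove m k))

justBelow-suc : ∀ m i → justBelow m (suc i) ≡ ⌊ m ≟ i ⌋
justBelow-suc m i = trans (isYes≗does (suc m ≟ suc i)) (sym (isYes≗does (m ≟ i)))

module Layered {n} (G : Graph n) (ℓ : Fin n → ℕ) where

  adj : Fin n → Fin n → Bool
  adj u v = lookup (N G v) u

  adj-sym : ∀ u v → adj u v ≡ adj v u
  adj-sym u v with adj u v in uv | adj v u in vu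
  ... | true  | true  = refl
  ... | false | false = refl
  ... | true  | false = trans (sym ([]=⇒lookup (symmetric G u v (lookup⇒[]= u (N G v) uv)))) vu
  ... | false | true  = trans (sym uv) ([]=⇒lookup (symmetric G v u (lookup⇒[]= v (N G u) vu)))

  adj-irrefl : ∀ v → adj v v ≡ false
  adj-irrefl v with adj v v in vv
  ... | false = refl
  ... | true  = ⊥-elim (irrefl G v (lookup⇒[]= v (N G v) vv))

  edge : (ℕ → ℕ → Bool) → Fin n → Fin n → ℕ
  edge R u v = 𝟙 (adj u v) * 𝟙 (R (ℓ u) (ℓ v))

  nbrs : (ℕ → ℕ → Bool) → Fin n → ℕ
  nbrs R v = sum λ u → edge R u v

  lower upper side : Fin n → ℕ
  lower = nbrs justBelow
  upper = nbrs justAbove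
  side  = nbrs apart

  -- Double counting: each R-edge seen from one end is a (flip R)-edge seen
  -- from the other.
  handshake : ∀ R → sum (nbrs R) ≡ sum (nbrs (flip R))
  handshake R = trans (∑-comm (λ v u → edge R u v))
    (sum-cong-≗ λ u → sum-cong-≗ λ v → cong (λ a → 𝟙 a * 𝟙 (R (ℓ u) (ℓ v))) (adj-sym u v))

  deg-split : ∀ v → deg G v ≡ lower v + upper v + side v
  deg-split v = begin
    ∣ N G v ∣                              ≡⟨ ∣p∣≡sum (N G v) ⟩
    sum (λ u → 𝟙 (adj u v))                ≡⟨ sum-cong-≗ split ⟩
    sum (λ u → edge justBelow u v + edge justAbove u v + edge apart u v)
                                          ≡⟨ ∑-distrib-+ (λ u → edge justBelow u v + edge justAbove u v) _ ⟩
    sum (λ u → edge justBelow u v + edge justAbove u v) + side v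
                                          ≡⟨ cong (_+ side v) (∑-distrib-+ (λ u → edge justBelow u v) _) ⟩
    lower v + upper v + side v             ∎
    where
    open ≡-Reasoning
    split : ∀ u → 𝟙 (adj u v) ≡ edge justBelow u v + edge justAbove u v + edge apart u v
    split u = scale-partition-of-one (𝟙 (adj u v)) _ _ _ (layer-trichotomy (ℓ u) (ℓ v))

  lower≡∣N∩layer∣ : ∀ v i → ℓ v ≡ suc i → ∣ N G v ∩ layer ℓ i ∣ ≡ lower v
  lower≡∣N∩layer∣ v i ℓv≡i+1 = trans (∣p∣≡sum (N G v ∩ layer ℓ i)) (sum-cong-≗ term)
    where
    open ≡-Reasoning
    term : ∀ u → 𝟙 (lookup (N G v ∩ layer ℓ i) u) ≡ edge justBelow u v
    term u = begin
      𝟙 (lookup (N G v ∩ layer ℓ i) u)     ≡⟨ cong 𝟙 (lookup-zipWith _∧_ u (N G v) (layer ℓ i)) ⟩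
      𝟙 (adj u v ∧ lookup (layer ℓ i) u)   ≡⟨ cong (𝟙 ∘ (adj u v ∧_)) (lookup∘tabulate _ u) ⟩
      𝟙 (adj u v ∧ ⌊ ℓ u ≟ i ⌋)            ≡⟨ 𝟙-∧ (adj u v) _ ⟩
      𝟙 (adj u v) * 𝟙 ⌊ ℓ u ≟ i ⌋          ≡⟨ cong (λ b → 𝟙 (adj u v) * 𝟙 b) (sym (justBelow-suc (ℓ u) i)) ⟩
      𝟙 (adj u v) * 𝟙 (justBelow (ℓ u) (suc i)) ≡⟨ cong (λ k → 𝟙 (adj u v) * 𝟙 (justBelow (ℓ u) k)) (sym ℓv≡i+1) ⟩
      edge justBelow u v                   ∎

  upper-top : ∀ w → (∀ u → ℓ u ≤ ℓ w) → upper w ≡ 0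
  upper-top w w-top = trans (sum-cong-≗ no-edge) (trans (sum-const n 0) (*-zeroʳ n))
    where
    no-edge : ∀ u → edge justAbove u w ≡ 0
    no-edge u with suc (ℓ w) ≟ ℓ u
    ... | yes ℓw+1≡ℓu = ⊥-elim (<-irrefl (sym ℓw+1≡ℓu) (s≤s (w-top u)))
    ... | no _        = *-zeroʳ (𝟙 (adj u w))

  -- Side edges come in pairs: a side neighbour x of w is another vertex
  -- having w as a side neighbour.
  side-partner : ∀ w → 0 < side w → ∃ λ x → w ≢ x × 0 < side x
  side-partner w 0<side with positive-term (λ u → edge apart u w) 0<side
  ... | x , 0<edge = x , w≢x , ≤-trans 0<edge (subst (_≤ side x) edge-sym (term≤sum _ w))
    where
    edge-sym : edge apart w x ≡ edge apart x w
    edge-sym = cong₂ (λ a b → 𝟙 a * 𝟙 b) (adj-sym w x) (apart-sym (ℓ w) (ℓ x))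
    w≢x : w ≢ x
    w≢x refl = <-irrefl (sym (cong (λ a → 𝟙 a * 𝟙 (apart (ℓ w) (ℓ w))) (adj-irrefl w))) 0<edge

  -- A vertex with a side neighbour forces Σ side ≥ 2, as its partner has one too.
  side-sum≥2 : ∀ w → 0 < side w → 2 ≤ sum side
  side-sum≥2 w 0<side-w with side-partner w 0<side-w
  ... | x , w≢x , 0<side-x = ≤-trans (+-mono-≤ 0<side-w 0<side-x) (two-terms≤sum side w≢x)

  lower-at-top : Cubic G → ∀ w → (∀ u → ℓ u ≤ ℓ w) → side w ≡ 0 → lower w ≡ 3
  lower-at-top cubic w w-top side-w≡0 = begin
    lower w                    ≡⟨ sym (trans (+-identityʳ _) (+-identityʳ _)) ⟩
    lower w + 0 + 0            ≡⟨ cong₂ (λ U S → lower w + U + S) (sym (upper-top w w-top)) (sym side-w≡0) ⟩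
    lower w + upper w + side w ≡⟨ sym (deg-split w) ⟩
    deg G w                    ≡⟨ cubic w ⟩
    3                          ∎
    where open ≡-Reasoning

module Monopoly {n} (G : Graph n) (D : Subset n) (ℓ : Fin n → ℕ)
                (witness : IsWeakDynMonWitness G (λ _ → 2) D ℓ) where
  open Layered G ℓ

  charge : Fin n → ℕ
  charge v = 2 * lower v + 4 * 𝟙 (lookup D v)

  -- Vertices of D pay 4 through the indicator; any other vertex has at least
  -- two neighbours in the previous layer.
  charge≥4 : ∀ v → 4 ≤ charge v
  charge≥4 v = by-layer (ℓ v) refl
    where
    by-layer : ∀ k → ℓ v ≡ k → 4 ≤ charge v
    by-layer zero ℓv≡0 =
      subst (λ b → 4 ≤ 2 * lower v + 4 * 𝟙 b)
            (sym ([]=⇒lookup (Equivalence.from (proj₁ witness v) ℓv≡0))) (m≤n+m 4 _)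
    by-layer (suc i) ℓv≡i+1 =
      ≤-trans (*-monoʳ-≤ 2 (subst (2 ≤_) (lower≡∣N∩layer∣ v i ℓv≡i+1) (proj₂ witness v i ℓv≡i+1)))
              (m≤m+n _ _)

  charge-sum : sum charge ≡ 2 * sum lower + 4 * ∣ D ∣
  charge-sum = begin
    sum charge                                          ≡⟨ ∑-distrib-+ (λ v → 2 * lower v) _ ⟩
    sum (λ v → 2 * lower v) + sum (λ v → 4 * 𝟙 (lookup D v))
      ≡⟨ cong₂ _+_ (sym (*-distribˡ-sum 2 lower)) (sym (*-distribˡ-sum 4 (𝟙 ∘ lookup D))) ⟩
    2 * sum lower + 4 * sum (𝟙 ∘ lookup D)              ≡⟨ cong (λ z → 2 * sum lower + 4 * z) (sym (∣p∣≡sum D)) ⟩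
    2 * sum lower + 4 * ∣ D ∣                           ∎
    where open ≡-Reasoning

  -- Summing the degree split over a cubic graph; lower and upper edges are
  -- the same edges counted from opposite ends.
  degree-sum : Cubic G → 2 * sum lower + sum side ≡ n * 3
  degree-sum cubic = begin
    2 * sum lower + sum side
      ≡⟨ cong (_+ sum side) (solve 1 (λ L → con 2 :* L := L :+ L) refl (sum lower)) ⟩
    sum lower + sum lower + sum side      ≡⟨ cong (λ U → sum lower + U + sum side) (handshake justBelow) ⟩
    sum lower + sum upper + sum side      ≡⟨ cong (_+ sum side) (sym (∑-distrib-+ lower upper)) ⟩
    sum (λ v → lower v + upper v) + sum side ≡⟨ sym (∑-distrib-+ (λ v → lower v + upper v) side) ⟩
    sum (λ v → lower v + upper v + side v) ≡⟨ sum-cong-≗ (λ v → trans (sym (deg-split v)) (cubic v)) ⟩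
    sum {n} (λ _ → 3)                     ≡⟨ sum-const n 3 ⟩
    n * 3                                 ∎
    where open ≡-Reasoning

  -- The charge bound (2), obtained at a vertex w of the last layer.
  top-bonus : Cubic G → ∀ w → (∀ u → ℓ u ≤ ℓ w) →
              ∃ λ e → n * 4 + e ≤ sum charge × 2 ≤ e + sum side
  top-bonus cubic w w-top with side w in side-w
  ... | zero  = 2 , sum-bonus charge w charge≥4 six≤charge , m≤m+n 2 _
    where
    six≤charge : 4 + 2 ≤ charge w
    six≤charge = ≤-trans (≤-reflexive (cong (2 *_) (sym (lower-at-top cubic w w-top side-w))))
                         (m≤m+n _ _)
  ... | suc _ = 0 , sum-bonus charge w charge≥4 (charge≥4 w) ,
                side-sum≥2 w (subst (0 <_) (sym side-w) (s≤s z≤n))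

-- The arithmetic combining (1) and (2), with X = 2·Σ lower and O = Σ side.
counting-bound : ∀ n e X O Z → n * 4 + e ≤ X + 4 * Z → X + O ≡ n * 3 → 2 ≤ e + O →
                 n + 2 ≤ 4 * Z
counting-bound n e X O Z bonus degrees spare = +-cancelˡ-≤ (n * 3) (n + 2) (4 * Z) (begin
  n * 3 + (n + 2)        ≤⟨ +-monoʳ-≤ (n * 3) (+-monoʳ-≤ n spare) ⟩
  n * 3 + (n + (e + O))  ≡⟨ solve 3 (λ n e O → n :* con 3 :+ (n :+ (e :+ O)) := n :* con 4 :+ e :+ O) refl n e O ⟩
  n * 4 + e + O          ≤⟨ +-monoˡ-≤ O bonus ⟩
  X + 4 * Z + O          ≡⟨ solve 3 (λ X Z O → X :+ con 4 :* Z :+ O := X :+ O :+ con 4 :* Z) refl X Z O ⟩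
  X + O + 4 * Z          ≡⟨ cong (_+ 4 * Z) degrees ⟩
  n * 3 + 4 * Z          ∎)
  where open ≤-Reasoning

theorem3 : (n : ℕ) → 1 ≤ n → (G : Graph n) → Cubic G →
    (D : Subset n) → IsWeakDynMon G (λ _ → 2) D → n + 2 ≤ 4 * ∣ D ∣
theorem3 (suc m) _ G cubic D (ℓ , witness) =
  let (w , w-top)           = maximum-attained ℓ
      (e , bonus , spare)   = top-bonus cubic w w-top
  in counting-bound (suc m) e (2 * sum lower) (sum side) ∣ D ∣
       (subst (suc m * 4 + e ≤_) charge-sum bonus) (degree-sum cubic) spare
  where
  open Layered G ℓ
  open Monopoly G D ℓ witness
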